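{- Let $\Delta$ be a finite signature and let $(\mathfrak{M},w)$, $(\mathfrak{N},v)$ be pointed $\Delta$-models. Then $(\mathfrak{M},w)$ and $(\mathfrak{N},v)$ are $\mathcal{L}$-elementarily equivalent (they satisfy the same $\mathcal{L}$-sentences over $\Delta$) if and only if $(\mathfrak{M},w)\approx_{tr}(\mathfrak{N},v)$ for all gameboard trees $tr$ whose root is labelled $\Delta$.
   Context: Hybrid-dynamic propositional logic (HDPL). A signature is $\Delta=((F,P),\mathtt{Prop})$ with $F$ a set of nominals, $P$ a set of binary relation symbols and $\mathtt{Prop}$ a set of propositional symbols. For a fresh symbol $x$, $\Delta[x]$ is $\Delta$ with $x$ added as a new nominal. A $\Delta$-model $\mathfrak{M}$ consists of a nonempty set $|\mathfrak{M}|$ of states, a state $k^{\mathfrak{M}}$ for each $k\in F$, a relation $\lambda^{\mathfrak{M}}\subseteq|\mathfrak{M}|^2$ for each $\lambda\in P$, and a map $M$ assigning to each state $w$ a set $M(w)\subseteq\mathtt{Prop}$. $\mathfrak{M}[x\leftarrow w]$ is the $\Delta[x]$-expansion interpreting $x$ as $w$. Actions: $\mathfrak{a}::=\lambda\mid\mathfrak{a}\cup\mathfrak{a}\mid\mathfrak{a};\mathfrak{a}\mid\mathfrak{a}^*$ ($\lambda\in P$), interpreted as union, composition, reflexive-transitive closure; $\mathfrak{a}^{\mathfrak{M}}(w)=\{w'\mid(w,w')\in\mathfrak{a}^{\mathfrak{M}}\}$. Sentences: $\phi::=p\mid k\mid\bigwedge\Phi\mid\neg\phi\mid\langle\mathfrak{a}\rangle\phi\mid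 @_k\phi\mid{\downarrow}x.\phi_x\mid\exists x.\phi_x$ ($\Phi$ finite, $\phi_x$ over $\Delta[x]$), with the standard local satisfaction at pointed models $(\mathfrak{M},w)$: $p$ iff $p\in M(w)$; $k$ iff $w=k^{\mathfrak{M}}$; $\langle\mathfrak{a}\rangle\phi$ iff $\phi$ holds at some $w'\in\mathfrak{a}^{\mathfrak{M}}(w)$; $@_k\phi$ iff $\phi$ holds at $k^{\mathfrak{M}}$; ${\downarrow}x.\phi_x$ iff $(\mathfrak{M}[x\leftarrow w],w)\models\phi_x$; $\exists x.\phi_x$ iff $(\mathfrak{M}[x\leftarrow u],w)\models\phi_x$ for some $u$. $\mathcal{L}$ is a fixed fragment of HDPL obtained by discarding some action constructors and/or some of the sentence constructors $\Diamond$ (possibility), $@$, $\downarrow$, $\exists$, keeping atoms and Boolean connectives; $\mathcal{O}\subseteq\{\Diamond,@,\downarrow,\exists\}$ is the set of retained constructors and $\mathcal{A}(\Delta)$ the $\mathcal{L}$-actions. Basic sentences: $\mathrm{Sen}_b(\Delta)=F\cup\mathtt{Prop}$. A gameboard tree is a finite rooted tree with nodes labelled by signatures and labelled edges (distinct labels out of each node), each edge being $\Delta\xrightarrow{\langle\mathfrak{a}\rangle}\Delta$ ($\mathfrak{a}\in\mathcal{A}(\Delta)$, only if $\Diamond\in\mathcal{O}$), $\Delta\xrightarrow{@_k}\Delta$ ($k$ nominal of $\Delta$, only if $@\in\mathcal{O}$), $\Delta\xrightarrow{\downarrow}\Delta[x]$ (only if $\downarrow\in\mathcal{O}$), $\Delta\xrightarrow{\exists}\Delta[x]$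 (only if $\exists\in\mathcal{O}$), or $\Delta\xrightarrow{1}\Delta$, with $x$ fresh. The EF game on $tr$ between Abelard and Eloise starts at the root with the two pointed models. At each position Eloise loses if the two current pointed models disagree on some basic sentence of the current node's signature (game property). Otherwise Abelard chooses an outgoing edge and one of the pointed models, say $(\mathfrak{M},w)$ (symmetrically for the other): $\langle\mathfrak{a}\rangle$: Abelard picks $w_1\in\mathfrak{a}^{\mathfrak{M}}(w)$, Eloise must pick $v_1\in\mathfrak{a}^{\mathfrak{N}}(v)$, new pair $(\mathfrak{M},w_1),(\mathfrak{N},v_1)$; $@_k$: new pair $(\mathfrak{M},k^{\mathfrak{M}}),(\mathfrak{N},k^{\mathfrak{N}})$; $\downarrow$: $(\mathfrak{M}[x\leftarrow w],w),(\mathfrak{N}[x\leftarrow v],v)$; $\exists$: Abelard picks $w_1\in|\mathfrak{M}|$, Eloise $v_1\in|\mathfrak{N}|$, new pair $(\mathfrak{M}[x\leftarrow w_1],w),(\mathfrak{N}[x\leftarrow v_1],v)$; $1$: unchanged. Eloise wins if the game property holds at every position reached; $(\mathfrak{M},w)\approx_{tr}(\mathfrak{N},v)$ means she has a winning strategy. -}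

module Defs where

open import Data.Nat using (ℕ; suc)
open import Data.Fin using (Fin; zero; suc)
open import Data.Bool using (Bool)
open import Data.Bool using (T)
open import Data.List using (List; []; _∷_; map)
open import Data.List.Relation.Unary.Unique.Propositional using (Unique)
open import Data.Product using (Σ; _×_; _,_; proj₁; proj₂)
open import Data.Sum using (_⊎_)
open import Data.Unit using (⊤)
open import Data.Empty using (⊥)
open import Function.Bundles using (_⇔_)
open import Relation.Binary.PropositionalEquality using (_≡_)
open import Relation.Binary.Construct.Closure.ReflexiveTransitive using (Star)

-- Finite signatures Δ = ((F , P) , Prop): nominals Fin nom, relation
-- symbols Fin rel, propositional symbols Fin prop.

record Sig : Set where
  constructor sig
  field
    nom  : ℕ
    rel  : ℕ
    prop : ℕ
open Sig public

-- Δ[x]: add one fresh nominal x.  Convention: x is `zero`, an old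
-- nominal k of Δ is `suc k` in Δ[x].
_[x] : Sig → Sig
Δ [x] = sig (suc (nom Δ)) (rel Δ) (prop Δ)

-- Fragments L: which action constructors and which sentence
-- constructors (◇, @, ↓, ∃) are retained.  Atomic actions, atoms and
-- Boolean connectives are always retained.

record Fragment : Set where
  field
    hasUnion  : Bool
    hasComp   : Bool
    hasStar   : Bool
    hasDia    : Bool
    hasAt     : Bool
    hasDown   : Bool
    hasExists : Bool
open Fragment public

data Act (L : Fragment) (n : ℕ) : Set where
  atom  : Fin n → Act L n
  union : T (hasUnion L) → Act L n → Act L n → Act L n
  comp  : T (hasComp L) → Act L n → Act L n → Act L n
  star  : T (hasStar L) → Act L n → Act L n

data Sen (L : Fragment) : Sig → Set where
  prp  : ∀ {Δ} → Fin (prop Δ) → Sen L Δ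
  nm   : ∀ {Δ} → Fin (nom Δ) → Sen L Δ
  conj : ∀ {Δ} → List (Sen L Δ) → Sen L Δ
  neg  : ∀ {Δ} → Sen L Δ → Sen L Δ
  dia  : ∀ {Δ} → T (hasDia L) → Act L (rel Δ) → Sen L Δ → Sen L Δ
  at   : ∀ {Δ} → T (hasAt L) → Fin (nom Δ) → Sen L Δ → Sen L Δ
  down : ∀ {Δ} → T (hasDown L) → Sen L (Δ [x]) → Sen L Δ
  ex   : ∀ {Δ} → T (hasExists L) → Sen L (Δ [x]) → Sen L Δ

record Model (Δ : Sig) : Set₁ where
  field
    St   : Set
    nomI : Fin (nom Δ) → St
    relI : Fin (rel Δ) → St → St → Set
    val  : St → Fin (prop Δ) → Set
open Model public

expand : ∀ {Δ} (M : Model Δ) → St M → Model (Δ [x])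
expand M w = record
  { St = St M
  ; nomI = λ { zero → w ; (suc k) → nomI M k }
  ; relI = relI M
  ; val = val M }

ActRel : ∀ {L Δ} (M : Model Δ) → Act L (rel Δ) → St M → St M → Set
ActRel M (atom l)      = relI M l
ActRel M (union _ a b) = λ x y → ActRel M a x y ⊎ ActRel M b x y
ActRel M (comp _ a b)  = λ x y → Σ (St M) λ z → ActRel M a x z × ActRel M b z y
ActRel M (star _ a)    = Star (ActRel M a)

mutual
  Sat : ∀ {L Δ} (M : Model Δ) → St M → Sen L Δ → Set
  Sat M w (prp p)      = val M w p
  Sat M w (nm k)       = w ≡ nomI M k
  Sat M w (conj Φ)     = SatAll M w Φ
  Sat M w (neg φ)      = Sat M w φ → ⊥
  Sat M w (dia _ a φ)  = Σ (St M) λ w' → ActRel M a w w' × Sat M w' φ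
  Sat M w (at _ k φ)   = Sat M (nomI M k) φ
  Sat M w (down _ φ)   = Sat (expand M w) w φ
  Sat M w (ex _ φ)     = Σ (St M) λ u → Sat (expand M u) w φ

  SatAll : ∀ {L Δ} (M : Model Δ) → St M → List (Sen L Δ) → Set
  SatAll M w []       = ⊤
  SatAll M w (φ ∷ Φ)  = Sat M w φ × SatAll M w Φ

ElemEquiv : ∀ (L : Fragment) {Δ} (M : Model Δ) → St M → (N : Model Δ) → St N → Set
ElemEquiv L {Δ} M w N v = (φ : Sen L Δ) → Sat M w φ ⇔ Sat N v φ

data Label (L : Fragment) (Δ : Sig) : Sig → Set where
  diaL  : T (hasDia L) → Act L (rel Δ) → Label L Δ Δ
  atL   : T (hasAt L) → Fin (nom Δ) → Label L Δ Δ
  downL : T (hasDown L) → Label L Δ (Δ [x])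
  exL   : T (hasExists L) → Label L Δ (Δ [x])
  oneL  : Label L Δ Δ

data Tree (L : Fragment) : Sig → Set where
  node : ∀ {Δ} (es : List (Σ Sig λ Δ' → Label L Δ Δ' × Tree L Δ'))
       → Unique (map (λ e → (proj₁ e , proj₁ (proj₂ e))) es)
       → Tree L Δ

Agree : ∀ {Δ} (M : Model Δ) → St M → (N : Model Δ) → St N → Set
Agree {Δ} M w N v =
  ((k : Fin (nom Δ)) → (w ≡ nomI M k) ⇔ (v ≡ nomI N k)) ×
  ((p : Fin (prop Δ)) → val M w p ⇔ val N v p)

mutual
  Win : ∀ {L Δ} → Tree L Δ → (M : Model Δ) → St M → (N : Model Δ) → St N → Set
  Win (node es _) M w N v = Agree M w N v × WinEdges es M w N v

  WinEdges : ∀ {L Δ} → List (Σ Sig λ Δ' → Label L Δ Δ' × Tree L Δ')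
           → (M : Model Δ) → St M → (N : Model Δ) → St N → Set
  WinEdges []                    M w N v = ⊤
  WinEdges ((_ , l , t) ∷ es)   M w N v = WinEdge l t M w N v × WinEdges es M w N v

  WinEdge : ∀ {L Δ Δ'} → Label L Δ Δ' → Tree L Δ'
          → (M : Model Δ) → St M → (N : Model Δ) → St N → Set
  WinEdge (diaL _ a) t M w N v =
    ((w₁ : St M) → ActRel M a w w₁ → Σ (St N) λ v₁ → ActRel N a v v₁ × Win t M w₁ N v₁) ×
    ((v₁ : St N) → ActRel N a v v₁ → Σ (St M) λ w₁ → ActRel M a w w₁ × Win t M w₁ N v₁)
  WinEdge (atL _ k) t M w N v = Win t M (nomI M k) N (nomI N k)
  WinEdge (downL _) t M w N v = Win t (expand M w) w (expand N v) v
  WinEdge (exL _) t M w N v =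
    ((w₁ : St M) → Σ (St N) λ v₁ → Win t (expand M w₁) w (expand N v₁) v) ×
    ((v₁ : St N) → Σ (St M) λ w₁ → Win t (expand M w₁) w (expand N v₁) v)
  WinEdge oneL t M w N v = Win t M w N v

_,_≈[_]_,_ : ∀ {L Δ} (M : Model Δ) → St M → Tree L Δ → (N : Model Δ) → St N → Set
M , w ≈[ tr ] N , v = Win tr M w N v

-- A gameboard tree tr has finitely many characteristic sentences: the basic
-- sentences of its root and, for each edge, the characteristic sentences of
-- the subtree prefixed by the edge's operator; for ◇ and ∃ the prefix is put
-- on the conjunction of each profile (a choice of φ or ¬φ for every subtree
-- sentence φ).  If two pointed models agree on these, Abelard's move to a
-- state is answered by a state with the same profile, so Eloise wins on tr;
-- determining the profile of a state is where excluded middle is used.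
-- Conversely, every sentence φ yields a tree following its syntax, and a
-- winning strategy on that tree transfers the truth of φ, by induction on φ.

module Submission where

open import Defs
open import Level using (0ℓ)
open import Axiom.ExcludedMiddle using (ExcludedMiddle)
open import Function.Bundles using (_⇔_; mk⇔; Equivalence)
import Function.Properties.Equivalence as ⇔
open import Function.Construct.Identity using (⇔-id)
open import Function.Related.TypeIsomorphisms using (¬-cong-⇔)
open import Data.Product.Function.NonDependent.Propositional using (_×-⇔_)
open import Data.Fin using (Fin)
open import Data.List using (List; []; _∷_; map; _++_; allFin)
open import Data.List.Relation.Unary.All using (All; []; _∷_; lookup)
import Data.List.Relation.Unary.All as All
open import Data.List.Relation.Unary.All.Properties using (++⁻; map⁻)
open import Data.List.Relation.Unary.Any using (here)
open import Data.List.Relation.Unary.AllPairs using ([]; _∷_)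
open import Data.List.Membership.Propositional.Properties
  using (∈-map⁺; ∈-++⁺ˡ; ∈-++⁺ʳ; ∈-allFin)
open import Data.List.Membership.Propositional using (_∈_)
open import Data.Product using (Σ; _×_; _,_; proj₁; proj₂)
open import Data.Unit using (tt)
open import Data.Bool using (T)
open import Data.Empty using (⊥; ⊥-elim)
open import Function using (_∘_)
open import Relation.Nullary using (Dec; yes; no)
open import Relation.Binary.PropositionalEquality using (_≡_; refl)

Σ-⇔-zigzag : {A B : Set} {P : A → Set} {Q : B → Set} (Z : A → B → Set) →
             (∀ {a b} → Z a b → P a ⇔ Q b) →
             (∀ a → Σ B (Z a)) → (∀ b → Σ A λ a → Z a b) →
             Σ A P ⇔ Σ B Q
Σ-⇔-zigzag Z transfer forth back = mk⇔
  (λ (a , p) → let (b , z) = forth a in b , Equivalence.to (transfer z) p)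
  (λ (b , q) → let (a , z) = back b in a , Equivalence.from (transfer z) q)

Σ-⇔-restricted-zigzag :
  {A B : Set} {R : A → Set} {S : B → Set} {P : A → Set} {Q : B → Set}
  (Z : A → B → Set) → (∀ {a b} → Z a b → P a ⇔ Q b) →
  (∀ a → R a → Σ B λ b → S b × Z a b) → (∀ b → S b → Σ A λ a → R a × Z a b) →
  (Σ A λ a → R a × P a) ⇔ (Σ B λ b → S b × Q b)
Σ-⇔-restricted-zigzag Z transfer forth back = mk⇔
  (λ (a , r , p) → let (b , s , z) = forth a r in b , s , Equivalence.to (transfer z) p)
  (λ (b , s , q) → let (a , r , z) = back b s in a , r , Equivalence.from (transfer z) q)

module _ {L : Fragment} where

  AgreeOn : ∀ {Δ} (M : Model Δ) → St M → (N : Model Δ) → St N → List (Sen L Δ) → Set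
  AgreeOn M w N v = All (λ φ → Sat M w φ ⇔ Sat N v φ)

  agreeOn-sym : ∀ {Δ} {M : Model Δ} {w} {N : Model Δ} {v} {Φ : List (Sen L Δ)} →
                AgreeOn M w N v Φ → AgreeOn N v M w Φ
  agreeOn-sym = All.map ⇔.sym

  elemEquiv⇒agreeOn : ∀ {Δ} {M : Model Δ} {w} {N : Model Δ} {v} →
                      ElemEquiv L M w N v → (Φ : List (Sen L Δ)) → AgreeOn M w N v Φ
  elemEquiv⇒agreeOn ee Φ = All.tabulate λ {φ} _ → ee φ

  profiles : ∀ {Δ} → List (Sen L Δ) → List (List (Sen L Δ))
  profiles []      = [] ∷ []
  profiles (φ ∷ Φ) = map (φ ∷_) (profiles Φ) ++ map (neg φ ∷_) (profiles Φ)

  signed : ∀ {Δ} {P : Set} → Dec P → Sen L Δ → Sen L Δ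
  signed (yes _) φ = φ
  signed (no _)  φ = neg φ

  module _ (em : ExcludedMiddle 0ℓ) where

    profile : ∀ {Δ} (M : Model Δ) → St M → List (Sen L Δ) → List (Sen L Δ)
    profile M w []      = []
    profile M w (φ ∷ Φ) = signed (em {Sat M w φ}) φ ∷ profile M w Φ

    profile∈profiles : ∀ {Δ} (M : Model Δ) w (Φ : List (Sen L Δ)) →
                       profile M w Φ ∈ profiles Φ
    profile∈profiles M w []      = here refl
    profile∈profiles M w (φ ∷ Φ) with em {Sat M w φ}
    ... | yes _ = ∈-++⁺ˡ (∈-map⁺ (φ ∷_) (profile∈profiles M w Φ))
    ... | no _  = ∈-++⁺ʳ (map (φ ∷_) (profiles Φ)) (∈-map⁺ (neg φ ∷_) (profile∈profiles M w Φ))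

    satAll-profile : ∀ {Δ} (M : Model Δ) w (Φ : List (Sen L Δ)) → SatAll M w (profile M w Φ)
    satAll-profile M w []      = tt
    satAll-profile M w (φ ∷ Φ) with em {Sat M w φ}
    ... | yes s  = s  , satAll-profile M w Φ
    ... | no ¬s = ¬s , satAll-profile M w Φ

    satAll-profile⇒agreeOn : ∀ {Δ} (M : Model Δ) w (N : Model Δ) v (Φ : List (Sen L Δ)) →
                             SatAll N v (profile M w Φ) → AgreeOn M w N v Φ
    satAll-profile⇒agreeOn M w N v []      _ = []
    satAll-profile⇒agreeOn M w N v (φ ∷ Φ) (s′ , ss) with em {Sat M w φ}
    ... | yes s  = mk⇔ (λ _ → s′) (λ _ → s) ∷ satAll-profile⇒agreeOn M w N v Φ ss
    ... | no ¬s = mk⇔ (⊥-elim ∘ ¬s) (⊥-elim ∘ s′) ∷ satAll-profile⇒agreeOn M w N v Φ ss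

  basicSens : (Δ : Sig) → List (Sen L Δ)
  basicSens Δ = map nm (allFin (nom Δ)) ++ map prp (allFin (prop Δ))

  agreeOn-basicSens⇒agree : ∀ {Δ} {M : Model Δ} {w} {N : Model Δ} {v} →
                            AgreeOn M w N v (basicSens Δ) → Agree M w N v
  agreeOn-basicSens⇒agree {Δ} ag =
    let (agN , agP) = ++⁻ (map nm (allFin (nom Δ))) ag
    in (λ k → lookup (map⁻ agN) (∈-allFin k)) , (λ p → lookup (map⁻ agP) (∈-allFin p))

  mutual
    charSens : ∀ {Δ} → Tree L Δ → List (Sen L Δ)
    charSens {Δ} (node es _) = basicSens Δ ++ edgesCharSens es

    edgesCharSens : ∀ {Δ} → List (Σ Sig λ Δ′ → Label L Δ Δ′ × Tree L Δ′) → List (Sen L Δ)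
    edgesCharSens []                 = []
    edgesCharSens ((_ , l , t) ∷ es) = edgeCharSens l t ++ edgesCharSens es

    edgeCharSens : ∀ {Δ Δ′} → Label L Δ Δ′ → Tree L Δ′ → List (Sen L Δ)
    edgeCharSens (diaL h a) t = map (λ π → dia h a (conj π)) (profiles (charSens t))
    edgeCharSens (atL h k)  t = map (at h k) (charSens t)
    edgeCharSens (downL h)  t = map (down h) (charSens t)
    edgeCharSens (exL h)    t = map (λ π → ex h (conj π)) (profiles (charSens t))
    edgeCharSens oneL       t = charSens t

  module _ (em : ExcludedMiddle 0ℓ) where

    ◇-forth : ∀ {Δ} {h : T (hasDia L)} {a : Act L (rel Δ)} {Φ : List (Sen L Δ)}
              {M : Model Δ} {w} {N : Model Δ} {v} →
              AgreeOn M w N v (map (λ π → dia h a (conj π)) (profiles Φ)) →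
              ∀ w₁ → ActRel M a w w₁ → Σ (St N) λ v₁ → ActRel N a v v₁ × AgreeOn M w₁ N v₁ Φ
    ◇-forth {Φ = Φ} {M} {N = N} ag w₁ r =
      let (v₁ , r′ , s) = Equivalence.to (lookup ag (∈-map⁺ _ (profile∈profiles em M w₁ Φ)))
                                         (w₁ , r , satAll-profile em M w₁ Φ)
      in v₁ , r′ , satAll-profile⇒agreeOn em M w₁ N v₁ Φ s

    ∃-forth : ∀ {Δ} {h : T (hasExists L)} {Φ : List (Sen L (Δ [x]))}
              {M : Model Δ} {w} {N : Model Δ} {v} →
              AgreeOn M w N v (map (λ π → ex h (conj π)) (profiles Φ)) →
              ∀ w₁ → Σ (St N) λ v₁ → AgreeOn (expand M w₁) w (expand N v₁) v Φ
    ∃-forth {Φ = Φ} {M} {w} {N} {v} ag w₁ =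
      let (v₁ , s) = Equivalence.to (lookup ag (∈-map⁺ _ (profile∈profiles em (expand M w₁) w Φ)))
                                    (w₁ , satAll-profile em (expand M w₁) w Φ)
      in v₁ , satAll-profile⇒agreeOn em (expand M w₁) w (expand N v₁) v Φ s

    mutual
      agreeOn-charSens⇒win : ∀ {Δ} (t : Tree L Δ) {M : Model Δ} {w} {N : Model Δ} {v} →
                             AgreeOn M w N v (charSens t) → Win t M w N v
      agreeOn-charSens⇒win {Δ} (node es _) ag =
        let (agB , agE) = ++⁻ (basicSens Δ) ag
        in agreeOn-basicSens⇒agree agB , agreeOn-edgesCharSens⇒winEdges es agE

      agreeOn-edgesCharSens⇒winEdges :
        ∀ {Δ} (es : List (Σ Sig λ Δ′ → Label L Δ Δ′ × Tree L Δ′)) {M : Model Δ} {w} {N : Model Δ} {v} →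
        AgreeOn M w N v (edgesCharSens es) → WinEdges es M w N v
      agreeOn-edgesCharSens⇒winEdges []                 _  = tt
      agreeOn-edgesCharSens⇒winEdges ((_ , l , t) ∷ es) ag =
        let (ag₁ , ag₂) = ++⁻ (edgeCharSens l t) ag
        in agreeOn-edgeCharSens⇒winEdge l t ag₁ , agreeOn-edgesCharSens⇒winEdges es ag₂

      agreeOn-edgeCharSens⇒winEdge :
        ∀ {Δ Δ′} (l : Label L Δ Δ′) (t : Tree L Δ′) {M : Model Δ} {w} {N : Model Δ} {v} →
        AgreeOn M w N v (edgeCharSens l t) → WinEdge l t M w N v
      agreeOn-edgeCharSens⇒winEdge (diaL h a) t ag =
          (λ w₁ r → let (v₁ , r′ , ag′) = ◇-forth ag w₁ r
                    in v₁ , r′ , agreeOn-charSens⇒win t ag′)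
        , (λ v₁ r → let (w₁ , r′ , ag′) = ◇-forth (agreeOn-sym ag) v₁ r
                    in w₁ , r′ , agreeOn-charSens⇒win t (agreeOn-sym ag′))
      agreeOn-edgeCharSens⇒winEdge (atL h k) t ag = agreeOn-charSens⇒win t (map⁻ ag)
      agreeOn-edgeCharSens⇒winEdge (downL h) t ag = agreeOn-charSens⇒win t (map⁻ ag)
      agreeOn-edgeCharSens⇒winEdge (exL h)   t ag =
          (λ w₁ → let (v₁ , ag′) = ∃-forth ag w₁ in v₁ , agreeOn-charSens⇒win t ag′)
        , (λ v₁ → let (w₁ , ag′) = ∃-forth (agreeOn-sym ag) v₁
                  in w₁ , agreeOn-charSens⇒win t (agreeOn-sym ag′))
      agreeOn-edgeCharSens⇒winEdge oneL      t ag = agreeOn-charSens⇒win t ag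

  data ProperLabel (Δ : Sig) : Sig → Set where
    diaP  : T (hasDia L) → Act L (rel Δ) → ProperLabel Δ Δ
    atP   : T (hasAt L) → Fin (nom Δ) → ProperLabel Δ Δ
    downP : T (hasDown L) → ProperLabel Δ (Δ [x])
    exP   : T (hasExists L) → ProperLabel Δ (Δ [x])

  toLabel : ∀ {Δ Δ′} → ProperLabel Δ Δ′ → Label L Δ Δ′
  toLabel (diaP h a) = diaL h a
  toLabel (atP h k)  = atL h k
  toLabel (downP h)  = downL h
  toLabel (exP h)    = exL h

  toLabel≢oneL : ∀ {Δ Δ′} (l : ProperLabel Δ Δ′) →
                 _≡_ {A = Σ Sig (Label L Δ)} (Δ′ , toLabel l) (Δ , oneL) → ⊥
  toLabel≢oneL (diaP h a) ()
  toLabel≢oneL (atP h k)  ()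
  toLabel≢oneL (downP h)  ()
  toLabel≢oneL (exP h)    ()

  Spine : Sig → Set
  Spine Δ = List (Σ Sig λ Δ′ → ProperLabel Δ Δ′ × Tree L Δ′)

  -- Edge labels out of a node must be distinct, so the edges of a spine are
  -- placed one per node, the nodes being linked by 1-edges.
  spineTree : ∀ {Δ} → Spine Δ → Tree L Δ
  spineTree []                  = node [] []
  spineTree {Δ} ((Δ′ , l , t) ∷ c) =
    node ((Δ′ , toLabel l , t) ∷ (Δ , oneL , spineTree c) ∷ [])
         ((toLabel≢oneL l ∷ []) ∷ [] ∷ [])

  WinSpine : ∀ {Δ} → Spine Δ → (M : Model Δ) → St M → (N : Model Δ) → St N → Set
  WinSpine c M w N v = All (λ (_ , l , t) → WinEdge (toLabel l) t M w N v) c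

  win-spineTree⇒ : ∀ {Δ} (c : Spine Δ) {M : Model Δ} {w} {N : Model Δ} {v} →
                   Win (spineTree c) M w N v → Agree M w N v × WinSpine c M w N v
  win-spineTree⇒ []      (ag , _)                = ag , []
  win-spineTree⇒ (_ ∷ c) (ag , (W , (Wc , _))) = ag , W ∷ proj₂ (win-spineTree⇒ c Wc)

  mutual
    senSpine : ∀ {Δ} → Sen L Δ → Spine Δ
    senSpine (prp p)          = []
    senSpine (nm k)           = []
    senSpine (conj Φ)         = sensSpine Φ
    senSpine (neg φ)          = senSpine φ
    senSpine {Δ} (dia h a φ)  = (Δ , diaP h a , senTree φ) ∷ []
    senSpine {Δ} (at h k φ)   = (Δ , atP h k , senTree φ) ∷ []
    senSpine {Δ} (down h φ)   = (Δ [x] , downP h , senTree φ) ∷ []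
    senSpine {Δ} (ex h φ)     = (Δ [x] , exP h , senTree φ) ∷ []

    sensSpine : ∀ {Δ} → List (Sen L Δ) → Spine Δ
    sensSpine []      = []
    sensSpine (φ ∷ Φ) = senSpine φ ++ sensSpine Φ

    senTree : ∀ {Δ} → Sen L Δ → Tree L Δ
    senTree φ = spineTree (senSpine φ)

  mutual
    winSpine⇒sat⇔ : ∀ {Δ} (φ : Sen L Δ) {M : Model Δ} {w} {N : Model Δ} {v} →
                    Agree M w N v → WinSpine (senSpine φ) M w N v → Sat M w φ ⇔ Sat N v φ
    winSpine⇒sat⇔ (prp p)     ag _  = proj₂ ag p
    winSpine⇒sat⇔ (nm k)      ag _  = proj₁ ag k
    winSpine⇒sat⇔ (conj Φ)    ag W  = winSpine⇒satAll⇔ Φ ag W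
    winSpine⇒sat⇔ (neg φ)     ag W  = ¬-cong-⇔ (winSpine⇒sat⇔ φ ag W)
    winSpine⇒sat⇔ (dia h a φ) {M} {N = N} _ ((forth , back) ∷ []) =
      Σ-⇔-restricted-zigzag (λ w₁ v₁ → Win (senTree φ) M w₁ N v₁) (win-senTree⇒sat⇔ φ) forth back
    winSpine⇒sat⇔ (at h k φ)  _ (W ∷ []) = win-senTree⇒sat⇔ φ W
    winSpine⇒sat⇔ (down h φ)  _ (W ∷ []) = win-senTree⇒sat⇔ φ W
    winSpine⇒sat⇔ (ex h φ) {M} {w} {N} {v} _ ((forth , back) ∷ []) =
      Σ-⇔-zigzag (λ w₁ v₁ → Win (senTree φ) (expand M w₁) w (expand N v₁) v)
                 (win-senTree⇒sat⇔ φ) forth back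

    winSpine⇒satAll⇔ : ∀ {Δ} (Φ : List (Sen L Δ)) {M : Model Δ} {w} {N : Model Δ} {v} →
                       Agree M w N v → WinSpine (sensSpine Φ) M w N v → SatAll M w Φ ⇔ SatAll N v Φ
    winSpine⇒satAll⇔ []      _  _ = ⇔-id _
    winSpine⇒satAll⇔ (φ ∷ Φ) ag W =
      let (W₁ , W₂) = ++⁻ (senSpine φ) W
      in winSpine⇒sat⇔ φ ag W₁ ×-⇔ winSpine⇒satAll⇔ Φ ag W₂

    win-senTree⇒sat⇔ : ∀ {Δ} (φ : Sen L Δ) {M : Model Δ} {w} {N : Model Δ} {v} →
                       Win (senTree φ) M w N v → Sat M w φ ⇔ Sat N v φ
    win-senTree⇒sat⇔ φ W = let (ag , Ws) = win-spineTree⇒ (senSpine φ) W in winSpine⇒sat⇔ φ ag Ws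

mainTheorem2 : ExcludedMiddle 0ℓ →
    (L : Fragment) (Δ : Sig) (M : Model Δ) (w : St M) (N : Model Δ) (v : St N) →
    ElemEquiv L M w N v ⇔ ((tr : Tree L Δ) → M , w ≈[ tr ] N , v)
mainTheorem2 em L Δ M w N v = mk⇔
  (λ ee tr → agreeOn-charSens⇒win em tr (elemEquiv⇒agreeOn ee (charSens tr)))
  (λ wins φ → win-senTree⇒sat⇔ φ (wins (senTree φ)))
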